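{- Let $G=(V,E)$ be a graph containing exactly $k$ triangles, and let $m$ denote the number of vertices of $G$ that do not lie on any triangle. Then the $\Delta$-Radon number satisfies $r_\Delta(G)\leq m+2k$.
   Context: All graphs are finite, simple, undirected and connected. A triangle is a set of three pairwise adjacent vertices (a copy of $K_3$). For $S\subseteq V$, the $\Delta$-interval $[S]$ is the set consisting of all vertices of $S$ together with every vertex $v\in V$ that is adjacent to both $x$ and $y$ for some pair of adjacent vertices $x,y\in S$. A set $S$ is $\Delta$-convex if $[S]=S$. The $\Delta$-convex hull $\langle S\rangle$ is the smallest $\Delta$-convex set containing $S$ (note $\langle\emptyset\rangle=\emptyset$). A set $S\subseteq V$ is Radon dependent if there is a partition $\{S_1,S_2\}$ of $S$ (so $S_1\cup S_2=S$, $S_1\cap S_2=\emptyset$) with $\langle S_1\rangle\cap\langle S_2\rangle\neq\emptyset$, and Radon independent otherwise. The Radon number $r_\Delta(G)$ is the least integer $n\ge0$ such that every $S\subseteq V$ with $|S|>n$ is Radon dependent (equivalently, the maximum size of a Radon independent set). -}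

module Defs where

open import Data.Nat using (ℕ; _<_)
open import Data.Bool using (Bool; true; false; _∧_; not)
open import Data.Fin using (Fin; toℕ)
open import Data.Fin.Subset using (Subset; _∈_; _⊆_; ∣_∣; _∩_)
open import Data.Vec using (tabulate)
open import Data.List using (List; []; _∷_; length; filter; allFin; concatMap; map)
open import Data.Bool.ListAction using (any)
open import Data.Product using (Σ; ∃; _×_; _,_)
open import Relation.Binary.PropositionalEquality using (_≡_)
open import Relation.Nullary using (¬_)
open import Data.Bool using (T)
open import Data.Bool.Properties using (T?)
open import Data.Nat using (_<ᵇ_)

record Graph : Set where
  field
    n        : ℕ
    adj      : Fin n → Fin n → Bool
    symm     : ∀ u v → adj u v ≡ adj v u
    irrefl   : ∀ v → adj v v ≡ false

  E : Fin n → Fin n → Set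
  E u v = adj u v ≡ true

data Walk (G : Graph) : Fin (Graph.n G) → Fin (Graph.n G) → Set where
  here  : ∀ {v} → Walk G v v
  step  : ∀ {u w v} → Graph.E G u w → Walk G w v → Walk G u v

Connected : Graph → Set
Connected G = ∀ u v → Walk G u v

module _ (G : Graph) where
  open Graph G

  isTriangle : Fin n × Fin n × Fin n → Bool
  isTriangle (a , b , c) =
    (toℕ a <ᵇ toℕ b) ∧ (toℕ b <ᵇ toℕ c) ∧ adj a b ∧ adj b c ∧ adj a c

  allTriples : List (Fin n × Fin n × Fin n)
  allTriples = concatMap (λ a → concatMap (λ b → map (λ c → (a , b , c)) (allFin n)) (allFin n)) (allFin n)

  -- number of triangles (each 3-set counted once, via increasing order)
  triangleCount : ℕ
  triangleCount = length (filter (λ t → T? (isTriangle t)) allTriples)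

  onTriangle : Fin n → Bool
  onTriangle v = any (λ a → any (λ b → adj v a ∧ adj v b ∧ adj a b) (allFin n)) (allFin n)

  nonTriangleVertexCount : ℕ
  nonTriangleVertexCount = ∣ tabulate (λ v → not (onTriangle v)) ∣

  InInterval : Subset n → Fin n → Set
  InInterval S v = v ∈ S ⊎' (∃ λ x → ∃ λ y → x ∈ S × y ∈ S × E x y × E v x × E v y)
    where
    open import Data.Sum renaming (_⊎_ to _⊎'_)

  -- Δ-convex: [S] = S  (i.e. [S] ⊆ S, since S ⊆ [S] always)
  Convex : Subset n → Set
  Convex S = ∀ v → InInterval S v → v ∈ S

  InHull : Subset n → Fin n → Set
  InHull S v = ∀ T → S ⊆ T → Convex T → v ∈ T

  RadonDependent : Subset n → Set
  RadonDependent S = ∃ λ S₁ → ∃ λ S₂ →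
    (∀ v → v ∈ S → (v ∈ S₁ ⊎' v ∈ S₂)) × S₁ ⊆ S × S₂ ⊆ S ×
    (∀ v → ¬ (v ∈ S₁ × v ∈ S₂)) ×
    (∃ λ v → InHull S₁ v × InHull S₂ v)
    where
    open import Data.Sum renaming (_⊎_ to _⊎'_)

  RadonNumber≤ : ℕ → Set
  RadonNumber≤ r = ∀ (S : Subset n) → r < ∣ S ∣ → RadonDependent S

-- If S contains all three vertices a, b, c of a triangle, then S is Radon dependent:
-- c lies in the Δ-hull of {a, b} because ab is an edge and c is adjacent to both ends,
-- so the partition S ∩ {a, b}, S ∖ {a, b} has c in both hulls. Otherwise S meets every
-- triangle in at most two vertices, and every vertex of S off the triangles is one of
-- the m such vertices, hence |S| ≤ m + 2k.
module Submission where

open import Defs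
open import Data.Nat using (ℕ; _+_; _*_; _≤_; _<_; s≤s; z≤n; _<ᵇ_)
open import Data.Nat.Properties
  using (<-cmp; ≤-trans; ≤-reflexive; +-mono-≤; +-suc; *-suc; m≤n+m; <⇒<ᵇ; <-≤-trans; <⇒≱; ≤-pred; module ≤-Reasoning)
open import Relation.Binary.PropositionalEquality using (_≡_; _≢_; refl; sym; trans; cong)
open import Relation.Binary using (tri<; tri≈; tri>)
open import Data.Bool using (true; false; not; T)
open import Data.Bool.Properties using (T?; T-≡; T-∧)
open import Data.Empty using (⊥-elim)
open import Data.Fin using (Fin; toℕ)
open import Data.Fin.Properties using (toℕ-injective)
open import Data.Fin.Subset using (Subset; _∈_; _∉_; ∣_∣; _∩_; _∪_; ⁅_⁆; ⊥; ∁; inside; outside)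
open import Data.Fin.Subset.Properties
  using ( _∈?_; x∈⁅x⁆; x∈⁅y⁆⇒x≡y; ∣⁅x⁆∣≡1; ∣⊥∣≡0; p⊆q⇒∣p∣≤∣q∣; p⊂q⇒∣p∣<∣q∣
        ; x∈p∪q⁺; x∈p∪q⁻; x∈p∩q⁺; x∈p∩q⁻; p∩q⊆p; p∩q⊆q; ∣p∩q∣≤∣q∣; ∩-distribˡ-∪; x∉p⇒x∈∁p; x∈∁p⇒x∉p)
open import Data.Vec using ([]; _∷_; tabulate)
open import Data.Vec.Properties using (lookup∘tabulate; lookup⇒[]=)
open import Data.List using (List; []; _∷_; length; filter; allFin; concatMap; map)
open import Data.List.Relation.Unary.Any using (here; there; any?; satisfied)
open import Data.List.Relation.Unary.Any.Properties using (any⁻)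
open import Data.List.Relation.Unary.All using (All; []; _∷_)
open import Data.List.Relation.Unary.All.Properties using (¬Any⇒All¬)
import Data.List.Membership.Propositional as List
open import Data.List.Membership.Propositional.Properties
  using (∈-filter⁺; ∈-filter⁻; ∈-concatMap⁺; ∈-map⁺; ∈-allFin)
open import Data.Product using (∃; _×_; _,_; proj₁; proj₂)
open import Data.Sum using (_⊎_; inj₁; inj₂)
open import Function.Bundles using (Equivalence)
open import Relation.Nullary using (¬_; Dec; yes; no)
open import Relation.Nullary.Decidable using (_×-dec_)

open Equivalence using (to; from)

∣p∪q∣≤∣p∣+∣q∣ : ∀ {n} (p q : Subset n) → ∣ p ∪ q ∣ ≤ ∣ p ∣ + ∣ q ∣
∣p∪q∣≤∣p∣+∣q∣ []            []            = z≤n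
∣p∪q∣≤∣p∣+∣q∣ (inside  ∷ p) (inside  ∷ q) =
  s≤s (≤-trans (∣p∪q∣≤∣p∣+∣q∣ p q) (≤-trans (m≤n+m _ 1) (≤-reflexive (sym (+-suc ∣ p ∣ ∣ q ∣)))))
∣p∪q∣≤∣p∣+∣q∣ (inside  ∷ p) (outside ∷ q) = s≤s (∣p∪q∣≤∣p∣+∣q∣ p q)
∣p∪q∣≤∣p∣+∣q∣ (outside ∷ p) (inside  ∷ q) =
  ≤-trans (s≤s (∣p∪q∣≤∣p∣+∣q∣ p q)) (≤-reflexive (sym (+-suc ∣ p ∣ ∣ q ∣)))
∣p∪q∣≤∣p∣+∣q∣ (outside ∷ p) (outside ∷ q) = ∣p∪q∣≤∣p∣+∣q∣ p q

∣⁅x⁆∪p∣≤1+∣p∣ : ∀ {n} (x : Fin n) (p : Subset n) → ∣ ⁅ x ⁆ ∪ p ∣ ≤ 1 + ∣ p ∣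
∣⁅x⁆∪p∣≤1+∣p∣ x p = ≤-trans (∣p∪q∣≤∣p∣+∣q∣ ⁅ x ⁆ p) (≤-reflexive (cong (_+ ∣ p ∣) (∣⁅x⁆∣≡1 x)))

∣p∩q∣<∣q∣ : ∀ {n} {x : Fin n} (p q : Subset n) → x ∈ q → x ∉ p → ∣ p ∩ q ∣ < ∣ q ∣
∣p∩q∣<∣q∣ p q x∈q x∉p = p⊂q⇒∣p∣<∣q∣ (p∩q⊆q p q , _ , x∈q , λ h → x∉p (proj₁ (x∈p∩q⁻ p q h)))

module _ {n : ℕ} where

  Triple : Set
  Triple = Fin n × Fin n × Fin n

  vertices : Triple → Subset n
  vertices (a , b , c) = ⁅ a ⁆ ∪ ⁅ b ⁆ ∪ ⁅ c ⁆

  ⋃vertices : List Triple → Subset n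
  ⋃vertices []       = ⊥
  ⋃vertices (t ∷ ts) = vertices t ∪ ⋃vertices ts

  ∈vertices⇒∈⋃vertices : ∀ {t ts v} → t List.∈ ts → v ∈ vertices t → v ∈ ⋃vertices ts
  ∈vertices⇒∈⋃vertices (here refl) v∈t = x∈p∪q⁺ (inj₁ v∈t)
  ∈vertices⇒∈⋃vertices (there t∈ts) v∈t = x∈p∪q⁺ (inj₂ (∈vertices⇒∈⋃vertices t∈ts v∈t))

  first∈vertices : ∀ {a b c} → a ∈ vertices (a , b , c)
  first∈vertices {a} = x∈p∪q⁺ (inj₁ (x∈⁅x⁆ a))

  second∈vertices : ∀ {a b c} → b ∈ vertices (a , b , c)
  second∈vertices {b = b} = x∈p∪q⁺ (inj₂ (x∈p∪q⁺ (inj₁ (x∈⁅x⁆ b))))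

  third∈vertices : ∀ {a b c} → c ∈ vertices (a , b , c)
  third∈vertices {c = c} = x∈p∪q⁺ (inj₂ (x∈p∪q⁺ (inj₂ (x∈⁅x⁆ c))))

  ∣vertices∣≤3 : ∀ t → ∣ vertices t ∣ ≤ 3
  ∣vertices∣≤3 (a , b , c) =
    ≤-trans (∣⁅x⁆∪p∣≤1+∣p∣ a _) (s≤s (≤-trans (∣⁅x⁆∪p∣≤1+∣p∣ b _) (s≤s (≤-reflexive (∣⁅x⁆∣≡1 c)))))

  Within : Subset n → Triple → Set
  Within S (a , b , c) = a ∈ S × b ∈ S × c ∈ S

  within? : ∀ S t → Dec (Within S t)
  within? S (a , b , c) = (a ∈? S) ×-dec (b ∈? S) ×-dec (c ∈? S)

  ¬Within⇒∃∉ : ∀ S t → ¬ Within S t → ∃ λ x → x ∈ vertices t × x ∉ S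
  ¬Within⇒∃∉ S (a , b , c) ¬within with a ∈? S | b ∈? S | c ∈? S
  ... | no a∉S  | _       | _       = a , first∈vertices , a∉S
  ... | yes _   | no b∉S  | _       = b , second∈vertices , b∉S
  ... | yes _   | yes _   | no c∉S  = c , third∈vertices , c∉S
  ... | yes a∈S | yes b∈S | yes c∈S = ⊥-elim (¬within (a∈S , b∈S , c∈S))

  ∣S∩vertices∣≤2 : ∀ S t → ¬ Within S t → ∣ S ∩ vertices t ∣ ≤ 2
  ∣S∩vertices∣≤2 S t ¬within with ¬Within⇒∃∉ S t ¬within
  ... | x , x∈t , x∉S = ≤-pred (<-≤-trans (∣p∩q∣<∣q∣ S (vertices t) x∈t x∉S) (∣vertices∣≤3 t))

  ∣S∩⋃vertices∣≤2*length : ∀ S ts → All (λ t → ¬ Within S t) ts → ∣ S ∩ ⋃vertices ts ∣ ≤ 2 * length ts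
  ∣S∩⋃vertices∣≤2*length S [] [] = ≤-trans (∣p∩q∣≤∣q∣ S ⊥) (≤-reflexive (∣⊥∣≡0 n))
  ∣S∩⋃vertices∣≤2*length S (t ∷ ts) (¬within ∷ ¬withins) = begin
    ∣ S ∩ (vertices t ∪ ⋃vertices ts) ∣         ≡⟨ cong ∣_∣ (∩-distribˡ-∪ S (vertices t) (⋃vertices ts)) ⟩
    ∣ S ∩ vertices t ∪ S ∩ ⋃vertices ts ∣       ≤⟨ ∣p∪q∣≤∣p∣+∣q∣ (S ∩ vertices t) (S ∩ ⋃vertices ts) ⟩
    ∣ S ∩ vertices t ∣ + ∣ S ∩ ⋃vertices ts ∣   ≤⟨ +-mono-≤ (∣S∩vertices∣≤2 S t ¬within) (∣S∩⋃vertices∣≤2*length S ts ¬withins) ⟩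
    2 + 2 * length ts                          ≡⟨ *-suc 2 (length ts) ⟨
    2 * length (t ∷ ts)                        ∎
    where open ≤-Reasoning

module _ (G : Graph) where
  open Graph G

  E-sym : ∀ {x y} → E x y → E y x
  E-sym {x} {y} xy = trans (symm y x) xy

  E⇒≢ : ∀ {x y} → E x y → x ≢ y
  E⇒≢ {x} xx refl with trans (sym xx) (irrefl x)
  ... | ()

  E⇒toℕ≢ : ∀ {x y} → E x y → toℕ x ≢ toℕ y
  E⇒toℕ≢ xy eq = E⇒≢ xy (toℕ-injective eq)

  ∈⇒InHull : ∀ {S v} → v ∈ S → InHull G S v
  ∈⇒InHull v∈S T S⊆T _ = S⊆T v∈S

  apex∈InHull : ∀ {S x y v} → x ∈ S → y ∈ S → E x y → E v x → E v y → InHull G S v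
  apex∈InHull x∈S y∈S xy vx vy T S⊆T convex = convex _ (inj₂ (_ , _ , S⊆T x∈S , S⊆T y∈S , xy , vx , vy))

  RadonDependent-split : ∀ S (P : Subset n) → (∃ λ v → InHull G (S ∩ P) v × InHull G (S ∩ ∁ P) v) →
                         RadonDependent G S
  RadonDependent-split S P common = S ∩ P , S ∩ ∁ P , cover , p∩q⊆p S P , p∩q⊆p S (∁ P) , disjoint , common
    where
    cover : ∀ v → v ∈ S → v ∈ S ∩ P ⊎ v ∈ S ∩ ∁ P
    cover v v∈S with v ∈? P
    ... | yes v∈P = inj₁ (x∈p∩q⁺ (v∈S , v∈P))
    ... | no  v∉P = inj₂ (x∈p∩q⁺ (v∈S , x∉p⇒x∈∁p v∉P))
    disjoint : ∀ v → ¬ (v ∈ S ∩ P × v ∈ S ∩ ∁ P)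
    disjoint v (v∈S∩P , v∈S∩∁P) = x∈∁p⇒x∉p (proj₂ (x∈p∩q⁻ S _ v∈S∩∁P)) (proj₂ (x∈p∩q⁻ S P v∈S∩P))

  IsTriangle : Triple → Set
  IsTriangle (a , b , c) = E a b × E b c × E a c

  Within-triangle⇒RadonDependent : ∀ S {t} → IsTriangle t → Within S t → RadonDependent G S
  Within-triangle⇒RadonDependent S {a , b , c} (ab , bc , ac) (a∈S , b∈S , c∈S) =
    RadonDependent-split S (⁅ a ⁆ ∪ ⁅ b ⁆)
      (c , apex∈InHull (x∈p∩q⁺ (a∈S , x∈p∪q⁺ (inj₁ (x∈⁅x⁆ a)))) (x∈p∩q⁺ (b∈S , x∈p∪q⁺ (inj₂ (x∈⁅x⁆ b))))
                       ab (E-sym ac) (E-sym bc)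
         , ∈⇒InHull (x∈p∩q⁺ (c∈S , x∉p⇒x∈∁p c∉ab)))
    where
    c∉ab : c ∉ ⁅ a ⁆ ∪ ⁅ b ⁆
    c∉ab c∈ab with x∈p∪q⁻ ⁅ a ⁆ ⁅ b ⁆ c∈ab
    ... | inj₁ c∈a = E⇒≢ ac (sym (x∈⁅y⁆⇒x≡y a c∈a))
    ... | inj₂ c∈b = E⇒≢ bc (sym (x∈⁅y⁆⇒x≡y b c∈b))

  triangles : List Triple
  triangles = filter (λ t → T? (isTriangle G t)) (allTriples G)

  T-isTriangle⇒IsTriangle : ∀ {a b c} → T (isTriangle G (a , b , c)) → IsTriangle (a , b , c)
  T-isTriangle⇒IsTriangle {a} {b} {c} _ with toℕ a <ᵇ toℕ b | toℕ b <ᵇ toℕ c | adj a b | adj b c | adj a c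
  ... | true | true | true | true | true = refl , refl , refl

  ordered-IsTriangle⇒T-isTriangle : ∀ {a b c} → toℕ a < toℕ b → toℕ b < toℕ c → IsTriangle (a , b , c) →
                                    T (isTriangle G (a , b , c))
  ordered-IsTriangle⇒T-isTriangle {a} {b} {c} a<b b<c (ab , bc , ac) rewrite ab | bc | ac
    with toℕ a <ᵇ toℕ b | <⇒<ᵇ a<b | toℕ b <ᵇ toℕ c | <⇒<ᵇ b<c
  ... | true | _ | true | _ = _

  ∈triangles⇒IsTriangle : ∀ {t} → t List.∈ triangles → IsTriangle t
  ∈triangles⇒IsTriangle t∈ =
    T-isTriangle⇒IsTriangle (proj₂ (∈-filter⁻ (λ t → T? (isTriangle G t)) {xs = allTriples G} t∈))

  ordered-triangle∈triangles : ∀ {a b c} → toℕ a < toℕ b → toℕ b < toℕ c → IsTriangle (a , b , c) →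
                               (a , b , c) List.∈ triangles
  ordered-triangle∈triangles {a} {b} {c} a<b b<c abc =
    ∈-filter⁺ (λ t → T? (isTriangle G t)) ∈allTriples (ordered-IsTriangle⇒T-isTriangle a<b b<c abc)
    where
    ∈allTriples : (a , b , c) List.∈ allTriples G
    ∈allTriples = ∈-concatMap⁺ _ (List.lose (∈-allFin a)
                    (∈-concatMap⁺ _ (List.lose (∈-allFin b) (∈-map⁺ (λ c′ → (a , b , c′)) (∈-allFin c)))))

  IsTriangle⇒∈⋃triangles : ∀ {x y z} → IsTriangle (x , y , z) → x ∈ ⋃vertices triangles
  IsTriangle⇒∈⋃triangles {x} {y} {z} (xy , yz , xz)
    with <-cmp (toℕ x) (toℕ y) | <-cmp (toℕ y) (toℕ z) | <-cmp (toℕ x) (toℕ z)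
  ... | tri≈ _ x≡y _ | _            | _            = ⊥-elim (E⇒toℕ≢ xy x≡y)
  ... | _            | tri≈ _ y≡z _ | _            = ⊥-elim (E⇒toℕ≢ yz y≡z)
  ... | _            | _            | tri≈ _ x≡z _ = ⊥-elim (E⇒toℕ≢ xz x≡z)
  ... | tri< x<y _ _ | tri< y<z _ _ | _            =
    ∈vertices⇒∈⋃vertices (ordered-triangle∈triangles x<y y<z (xy , yz , xz)) first∈vertices
  ... | tri< _ _ _   | tri> _ _ z<y | tri< x<z _ _ =
    ∈vertices⇒∈⋃vertices (ordered-triangle∈triangles x<z z<y (xz , E-sym yz , xy)) first∈vertices
  ... | tri< x<y _ _ | tri> _ _ _   | tri> _ _ z<x =
    ∈vertices⇒∈⋃vertices (ordered-triangle∈triangles z<x x<y (E-sym xz , xy , E-sym yz)) second∈vertices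
  ... | tri> _ _ y<x | tri< _ _ _   | tri< x<z _ _ =
    ∈vertices⇒∈⋃vertices (ordered-triangle∈triangles y<x x<z (E-sym xy , xz , yz)) second∈vertices
  ... | tri> _ _ _   | tri< y<z _ _ | tri> _ _ z<x =
    ∈vertices⇒∈⋃vertices (ordered-triangle∈triangles y<z z<x (yz , E-sym xz , E-sym xy)) third∈vertices
  ... | tri> _ _ y<x | tri> _ _ z<y | _            =
    ∈vertices⇒∈⋃vertices (ordered-triangle∈triangles z<y y<x (E-sym yz , E-sym xy , E-sym xz)) third∈vertices

  onTriangle⇒∈⋃triangles : ∀ v → onTriangle G v ≡ true → v ∈ ⋃vertices triangles
  onTriangle⇒∈⋃triangles v onTri with satisfied (any⁻ _ (allFin n) (from T-≡ onTri))
  ... | a , onTri′ with satisfied (any⁻ _ (allFin n) onTri′)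
  ... | b , vab with to (T-∧ {adj v a}) vab
  ... | va , vbab with to (T-∧ {adj v b}) vbab
  ... | vb , ab = IsTriangle⇒∈⋃triangles (to T-≡ va , to T-≡ ab , to T-≡ vb)

  nonTriangleVertices : Subset n
  nonTriangleVertices = tabulate (λ v → not (onTriangle G v))

  ∈nonTriangleVertices∪⋃triangles : ∀ v → v ∈ nonTriangleVertices ∪ ⋃vertices triangles
  ∈nonTriangleVertices∪⋃triangles v with onTriangle G v in onTri
  ... | true  = x∈p∪q⁺ (inj₂ (onTriangle⇒∈⋃triangles v onTri))
  ... | false = x∈p∪q⁺ (inj₁ (lookup⇒[]= v nonTriangleVertices (trans (lookup∘tabulate _ v) (cong not onTri))))

  ∣S∣≤nonTriangleVertexCount+2*triangleCount : ∀ S → All (λ t → ¬ Within S t) triangles →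
                                              ∣ S ∣ ≤ nonTriangleVertexCount G + 2 * triangleCount G
  ∣S∣≤nonTriangleVertexCount+2*triangleCount S ¬withins = begin
    ∣ S ∣                    ≤⟨ p⊆q⇒∣p∣≤∣q∣ {p = S} (λ {v} v∈S → x∈p∩q⁺ (v∈S , ∈nonTriangleVertices∪⋃triangles v)) ⟩
    ∣ S ∩ (N ∪ Δ) ∣          ≡⟨ cong ∣_∣ (∩-distribˡ-∪ S N Δ) ⟩
    ∣ S ∩ N ∪ S ∩ Δ ∣        ≤⟨ ∣p∪q∣≤∣p∣+∣q∣ (S ∩ N) (S ∩ Δ) ⟩
    ∣ S ∩ N ∣ + ∣ S ∩ Δ ∣    ≤⟨ +-mono-≤ (∣p∩q∣≤∣q∣ S N) (∣S∩⋃vertices∣≤2*length S triangles ¬withins) ⟩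
    ∣ N ∣ + 2 * length triangles ∎
    where
    open ≤-Reasoning
    N Δ : Subset n
    N = nonTriangleVertices
    Δ = ⋃vertices triangles

theorem4 : (G : Graph) → Connected G → (k m : ℕ) →
    triangleCount G ≡ k → nonTriangleVertexCount G ≡ m →
    RadonNumber≤ G (m + 2 * k)
theorem4 G _ k m refl refl S m+2k<∣S∣ with any? (within? S) (triangles G)
... | yes some-within with List.find some-within
...   | t , t∈triangles , within = Within-triangle⇒RadonDependent G S (∈triangles⇒IsTriangle G t∈triangles) within
theorem4 G _ k m refl refl S m+2k<∣S∣ | no none-within =
  ⊥-elim (<⇒≱ m+2k<∣S∣ (∣S∣≤nonTriangleVertexCount+2*triangleCount G S (¬Any⇒All¬ (triangles G) none-within)))
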